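{- For every positive integer $r$, \[ \sum_{n\ge0}\sum_{\gamma\in G(r,n)}t^{\mathrm{des}_G(\gamma)}a^{\mathrm{col}(\gamma)}\frac{u^n}{n!}=\frac{(1-t)\exp\big(u(1-t)\big)}{1-t\exp\big((1+a[r-1]_a)u(1-t)\big)}. \]
   Context: $[r-1]_a=1+a+\dots+a^{r-2}$. $G(r,n)$ is the set of $r$-colored permutations $\gamma=(c_1,\dots,c_n;\sigma)$, $c_i\in\{0,\dots,r-1\}$, $\sigma\in S_n$, written $\gamma=[\gamma(1),\dots,\gamma(n)]=[\sigma(1)^{c_1},\dots,\sigma(n)^{c_n}]$. Colored integers $x^c$ ($x^0=x$) are totally ordered by: uncolored integers in natural order; every $x^c$ with $c\ge1$ is smaller than every uncolored integer (including $0$); for $c,d\ge1$, $x^c<y^d$ iff $x>y$, or $x=y$ and $c>d$. $\mathrm{Des}_G(\gamma)=\{i\in\{0,\dots,n-1\}:\gamma(i)>\gamma(i+1)\}$ with $\gamma(0):=0$; $\mathrm{des}_G=|\mathrm{Des}_G|$; $\mathrm{col}(\gamma)=\sum_ic_i$. -}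

module Defs where

open import Data.Nat as ℕ using (ℕ; zero; suc; _<ᵇ_; _≡ᵇ_; _∸_)
open import Data.Nat.Combinatorics using (_C_)
open import Data.Bool using (Bool; true; false; _∧_; _∨_; if_then_else_)
open import Data.List using (List; []; _∷_; [_]; map; concatMap; upTo; filterᵇ; cartesianProduct; foldr)
open import Data.Bool.ListAction using (all; any)
open import Data.Product using (_×_; _,_; proj₁; proj₂)
open import Data.Integer as ℤ using (ℤ; +_; _+_; _*_; _-_; _^_)

-- A colored integer x^c is the pair (x , c); color 0 means uncolored.
ColInt : Set
ColInt = ℕ × ℕ

_<ᶜ_ : ColInt → ColInt → Bool
(x , zero)  <ᶜ (y , zero)  = x <ᵇ y
(x , suc _) <ᶜ (y , zero)  = true
(x , zero)  <ᶜ (y , suc _) = false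
(x , suc c) <ᶜ (y , suc d) = (y <ᵇ x) ∨ ((x ≡ᵇ y) ∧ (d <ᵇ c))

words : {A : Set} → ℕ → List A → List A → List (List A)
words zero    xs acc = [ acc ]
words (suc n) xs acc = concatMap (λ x → words n xs (x ∷ acc)) xs

letters : ℕ → ℕ → List ColInt
letters r n = cartesianProduct (map suc (upTo n)) (upTo r)

-- A word of length n whose underlying values contain every 1..n is a permutation.
isPermWord : ℕ → List ColInt → Bool
isPermWord n w = all (λ v → any (λ p → v ≡ᵇ proj₁ p) w) (map suc (upTo n))

G : ℕ → ℕ → List (List ColInt)
G r n = filterᵇ (isPermWord n) (words n (letters r n) [])

descents : ColInt → List ColInt → ℕ
descents p []      = 0
descents p (q ∷ w) = (if q <ᶜ p then 1 else 0) ℕ.+ descents q w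

-- des_G, with γ(0) := 0 (uncolored).
desG : List ColInt → ℕ
desG w = descents (0 , 0) w

col : List ColInt → ℕ
col w = foldr (λ p s → proj₂ p ℕ.+ s) 0 w

sumℤ : List ℤ → ℤ
sumℤ = foldr _+_ (+ 0)

F : ℕ → ℕ → ℤ → ℤ → ℤ
F r n t a = sumℤ (map (λ γ → (t ^ desG γ) * (a ^ col γ)) (G r n))

qint : ℕ → ℤ → ℤ
qint k a = sumℤ (map (a ^_) (upTo k))

-- Product of exponential generating series: coefficient of u^n/n! in (Σ f_k u^k/k!)(Σ g_k u^k/k!).
egfProd : (ℕ → ℤ) → (ℕ → ℤ) → ℕ → ℤ
egfProd f g n = sumℤ (map (λ k → (+ (n C k)) * f k * g (n ∸ k)) (upTo (suc n)))

-- Coefficient of u^j/j! in the denominator 1 - t exp((1 + a[r-1]_a) u (1-t)).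
denomCoeff : ℕ → ℤ → ℤ → ℕ → ℤ
denomCoeff r t a zero    = + 1 - t
denomCoeff r t a (suc j) = (+ 0) - t * (((+ 1 + a * qint (r ∸ 1) a) * (+ 1 - t)) ^ suc j)

-- Coefficient of u^n/n! in the numerator (1-t) exp(u(1-t)).
numCoeff : ℤ → ℕ → ℤ
numCoeff t n = (+ 1 - t) * ((+ 1 - t) ^ n)

-- Fix a colored letter p and a strictly increasing list V of labels not containing
-- the value of p, and let P_T(p) be the sum of t^des a^col over the colored
-- permutations of T ⊆ V read after γ(0) := p.  The coefficient identity of the
-- theorem generalises to
--   Σ_{T ⊆ V} P_T(p) D_{|V|-|T|} = (1-t)^{|V|+1} Φ_V(p),
-- with D_j the coefficients of the denominator and Φ explicit.  It is proved by
-- induction on |V|: splitting off the first letter x^c of each permutation and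
-- exchanging the sum over T ⊆ V with the choice of x ∈ T leaves D_{|V|} plus the
-- induction hypothesis for V ∖ x read after x^c, and what remains is an explicit
-- identity for Φ.  For p = 0 and V = [1..n] we have Φ = 1, and the left-hand side is
-- the convolution in the theorem as soon as P_T depends only on |T|.  That follows
-- from the identity itself: for t ≠ 1 it determines P_T from the values on proper
-- subsets by the same recursion for every T of a given size.  At t = 1 all D_j vanish.

module Submission where

open import Defs
open import Data.Nat using (ℕ; _≤_)
open import Data.Integer using (ℤ)
open import Relation.Binary.PropositionalEquality using (_≡_)

open import Data.Bool using (Bool; true; false; if_then_else_; _∧_; T)
open import Data.Bool.ListAction using (all; any)
open import Data.Empty using (⊥-elim)
open import Data.Integer using (+_; _+_; _*_; _-_; _^_; ≢-nonZero)
import Data.Integer.Properties as ℤ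
open import Data.Integer.Tactic.RingSolver using (solve-∀)
open import Data.List using (List; []; _∷_; [_]; _++_; map; concatMap; upTo; filterᵇ; cartesianProduct; length)
open import Data.List.Properties using (map-upTo; upTo-∷ʳ; length-map; length-upTo; ++-identityʳ; ++-assoc)
open import Data.List.Membership.Propositional using (_∈_; _∉_)
open import Data.List.Relation.Unary.All as All using (All; []; _∷_)
open import Data.List.Relation.Unary.All.Properties as All using ()
open import Data.List.Relation.Unary.AllPairs as AllPairs using (AllPairs; []; _∷_)
import Data.List.Relation.Unary.AllPairs.Properties as AllPairs
open import Data.List.Relation.Unary.Any using (here; there)
open import Data.List.Relation.Unary.Unique.Propositional using (Unique)
open import Data.List.Relation.Binary.Sublist.Propositional using (_⊆_; []; _∷_; _∷ʳ_; ⊆-refl; ⊆-trans)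
open import Data.List.Relation.Binary.Sublist.Propositional.Properties using (All-resp-⊆; Any-resp-⊆; length-mono-≤)
open import Data.Nat using (zero; suc; s≤s; z≤n; _<_; _<ᵇ_; _≡ᵇ_; _∸_; _≟_)
import Data.Nat.Properties as ℕ
open import Data.Nat.Combinatorics using (_C_; nCk+nC[k+1]≡[n+1]C[k+1]; k>n⇒nCk≡0)
open import Data.Nat.Induction using (<-rec)
open import Algebra.Bundles using (AbelianGroup)
open import Algebra.Properties.Group (AbelianGroup.group ℤ.+-0-abelianGroup) using (∙-cancelʳ)
open import Data.Product using (_×_; _,_; proj₁; proj₂)
open import Function using (_∘_; Equivalence)
open import Data.Bool.Properties using (T-≡; T-∧)
open import Relation.Binary.Definitions using (tri<; tri≈; tri>)
open import Relation.Binary.PropositionalEquality using (refl; sym; trans; cong; cong₂; subst; subst₂; _≢_; module ≡-Reasoning)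
open import Relation.Nullary using (¬_; yes; no)

open ≡-Reasoning

private variable X Y : Set

-- Sums over lists

∑ : List X → (X → ℤ) → ℤ
∑ xs f = sumℤ (map f xs)

infix 8 ∑
syntax ∑ xs (λ x → e) = ∑[ x ∈ xs ] e

∑-++ : (xs ys : List X) (f : X → ℤ) → ∑ (xs ++ ys) f ≡ ∑ xs f + ∑ ys f
∑-++ []       ys f = sym (ℤ.+-identityˡ _)
∑-++ (x ∷ xs) ys f = trans (cong (_+_ (f x)) (∑-++ xs ys f)) (sym (ℤ.+-assoc (f x) _ _))

∑-cong : (xs : List X) {f g : X → ℤ} → (∀ x → f x ≡ g x) → ∑ xs f ≡ ∑ xs g
∑-cong []       f≡g = refl
∑-cong (x ∷ xs) f≡g = cong₂ _+_ (f≡g x) (∑-cong xs f≡g)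

∑-cong-∈ : (xs : List X) {f g : X → ℤ} → (∀ x → x ∈ xs → f x ≡ g x) → ∑ xs f ≡ ∑ xs g
∑-cong-∈ []       f≡g = refl
∑-cong-∈ (x ∷ xs) f≡g = cong₂ _+_ (f≡g x (here refl)) (∑-cong-∈ xs (λ y y∈xs → f≡g y (there y∈xs)))

∑-zero : (xs : List X) → ∑[ x ∈ xs ] + 0 ≡ + 0
∑-zero []       = refl
∑-zero (x ∷ xs) = trans (ℤ.+-identityˡ _) (∑-zero xs)

∑-distrib-+ : (xs : List X) (f g : X → ℤ) → ∑[ x ∈ xs ] (f x + g x) ≡ ∑ xs f + ∑ xs g
∑-distrib-+ []       f g = refl
∑-distrib-+ (x ∷ xs) f g = trans (cong (_+_ (f x + g x)) (∑-distrib-+ xs f g)) (interchange (f x) (g x) _ _)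
  where
  interchange : ∀ a b c d → a + b + (c + d) ≡ a + c + (b + d)
  interchange = solve-∀

∑-*ˡ : (xs : List X) (k : ℤ) (f : X → ℤ) → ∑[ x ∈ xs ] (k * f x) ≡ k * ∑ xs f
∑-*ˡ []       k f = sym (ℤ.*-zeroʳ k)
∑-*ˡ (x ∷ xs) k f = trans (cong (_+_ (k * f x)) (∑-*ˡ xs k f)) (sym (ℤ.*-distribˡ-+ k (f x) _))

∑-*ʳ : (xs : List X) (f : X → ℤ) (k : ℤ) → ∑ xs f * k ≡ ∑[ x ∈ xs ] (f x * k)
∑-*ʳ xs f k = trans (ℤ.*-comm (∑ xs f) k) (trans (sym (∑-*ˡ xs k f)) (∑-cong xs (λ x → ℤ.*-comm k (f x))))

∑-filterᵇ : (P : X → Bool) (xs : List X) (f : X → ℤ) →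
            ∑ (filterᵇ P xs) f ≡ ∑[ x ∈ xs ] (if P x then f x else + 0)
∑-filterᵇ P []       f = refl
∑-filterᵇ P (x ∷ xs) f with P x
... | true  = cong (_+_ (f x)) (∑-filterᵇ P xs f)
... | false = trans (∑-filterᵇ P xs f) (sym (ℤ.+-identityˡ _))

∑-map : (xs : List X) (g : X → Y) (f : Y → ℤ) → ∑ (map g xs) f ≡ ∑ xs (f ∘ g)
∑-map []       g f = refl
∑-map (x ∷ xs) g f = cong (_+_ (f (g x))) (∑-map xs g f)

∑-concatMap : (xs : List X) (h : X → List Y) (f : Y → ℤ) →
              ∑ (concatMap h xs) f ≡ ∑[ x ∈ xs ] ∑ (h x) f
∑-concatMap []       h f = refl
∑-concatMap (x ∷ xs) h f = trans (∑-++ (h x) _ f) (cong (_+_ (∑ (h x) f)) (∑-concatMap xs h f))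

∑-comm : (xs : List X) (ys : List Y) (f : X → Y → ℤ) →
         ∑[ x ∈ xs ] ∑[ y ∈ ys ] f x y ≡ ∑[ y ∈ ys ] ∑[ x ∈ xs ] f x y
∑-comm []       ys f = sym (∑-zero ys)
∑-comm (x ∷ xs) ys f = trans (cong (_+_ (∑ ys (f x))) (∑-comm xs ys f)) (sym (∑-distrib-+ ys (f x) _))

∑-cartesianProduct : (xs : List X) (ys : List Y) (f : X × Y → ℤ) →
                     ∑ (cartesianProduct xs ys) f ≡ ∑[ x ∈ xs ] ∑[ y ∈ ys ] f (x , y)
∑-cartesianProduct []       ys f = refl
∑-cartesianProduct (x ∷ xs) ys f =
  trans (∑-++ (map (x ,_) ys) _ f) (cong₂ _+_ (∑-map ys (x ,_) f) (∑-cartesianProduct xs ys f))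

∑-upTo-suc : ∀ n (f : ℕ → ℤ) → ∑ (upTo (suc n)) f ≡ f 0 + ∑[ k ∈ upTo n ] f (suc k)
∑-upTo-suc n f = cong (_+_ (f 0)) (trans (cong (λ ks → ∑ ks f) (sym (map-upTo suc n))) (∑-map (upTo n) suc f))

∑-upTo-last : ∀ n (f : ℕ → ℤ) → f n ≡ + 0 → ∑ (upTo (suc n)) f ≡ ∑ (upTo n) f
∑-upTo-last n f fn≡0 = begin
  ∑ (upTo (suc n)) f         ≡⟨ cong (λ ks → ∑ ks f) (sym (upTo-∷ʳ n)) ⟩
  ∑ (upTo n ++ [ n ]) f      ≡⟨ ∑-++ (upTo n) [ n ] f ⟩
  ∑ (upTo n) f + (f n + + 0) ≡⟨ cong (λ y → ∑ (upTo n) f + (y + + 0)) fn≡0 ⟩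
  ∑ (upTo n) f + + 0         ≡⟨ ℤ.+-identityʳ _ ⟩
  ∑ (upTo n) f               ∎

qint-suc : ∀ k a → qint (suc k) a ≡ + 1 + a * qint k a
qint-suc k a = trans (∑-upTo-suc k (a ^_)) (cong (_+_ (+ 1)) (∑-*ˡ (upTo k) a (a ^_)))

^-distribʳ-* : ∀ x y n → (x * y) ^ n ≡ x ^ n * y ^ n
^-distribʳ-* x y zero    = refl
^-distribʳ-* x y (suc n) = trans (cong (x * y *_) (^-distribʳ-* x y n)) (interchange x y (x ^ n) (y ^ n))
  where
  interchange : ∀ x y X Y → x * y * (X * Y) ≡ x * X * (y * Y)
  interchange = solve-∀

-- Sums over words

∑Words : ℕ → List X → (List X → ℤ) → ℤ
∑Words zero    L g = g []
∑Words (suc k) L g = ∑[ q ∈ L ] ∑Words k L (λ w → g (q ∷ w))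

∑Words-cong : ∀ k (L : List X) {g h : List X → ℤ} →
              (∀ w → length w ≡ k → g w ≡ h w) → ∑Words k L g ≡ ∑Words k L h
∑Words-cong zero    L g≡h = g≡h [] refl
∑Words-cong (suc k) L g≡h = ∑-cong L (λ q → ∑Words-cong k L (λ w |w|≡k → g≡h (q ∷ w) (cong suc |w|≡k)))

∑Words-zero : ∀ k (L : List X) → ∑Words k L (λ _ → + 0) ≡ + 0
∑Words-zero zero    L = refl
∑Words-zero (suc k) L = trans (∑-cong L (λ _ → ∑Words-zero k L)) (∑-zero L)

∑Words-*ˡ : ∀ k (L : List X) (c : ℤ) (g : List X → ℤ) → ∑Words k L (λ w → c * g w) ≡ c * ∑Words k L g
∑Words-*ˡ zero    L c g = refl
∑Words-*ˡ (suc k) L c g = trans (∑-cong L (λ q → ∑Words-*ˡ k L c (λ w → g (q ∷ w)))) (∑-*ˡ L c _)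

∑Words-snoc : ∀ k (L : List X) (g : List X → ℤ) →
              ∑Words (suc k) L g ≡ ∑[ x ∈ L ] ∑Words k L (λ w → g (w ++ [ x ]))
∑Words-snoc zero    L g = refl
∑Words-snoc (suc k) L g = trans (∑-cong L (λ q → ∑Words-snoc k L (λ w → g (q ∷ w))))
                                (∑-comm L L (λ q x → ∑Words k L (λ w → g (q ∷ w ++ [ x ]))))

∑-words : ∀ k (L acc : List X) (g : List X → ℤ) → ∑ (words k L acc) g ≡ ∑Words k L (λ w → g (w ++ acc))
∑-words zero    L acc g = ℤ.+-identityʳ (g acc)
∑-words (suc k) L acc g = begin
  ∑ (concatMap (λ x → words k L (x ∷ acc)) L) g
    ≡⟨ ∑-concatMap L (λ x → words k L (x ∷ acc)) g ⟩
  ∑[ x ∈ L ] ∑ (words k L (x ∷ acc)) g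
    ≡⟨ ∑-cong L (λ x → trans (∑-words k L (x ∷ acc) g)
                             (∑Words-cong k L (λ w _ → cong g (sym (++-assoc w [ x ] acc))))) ⟩
  ∑[ x ∈ L ] ∑Words k L (λ w → g ((w ++ [ x ]) ++ acc))
    ≡⟨ ∑Words-snoc k L (λ w → g (w ++ acc)) ⟨
  ∑Words (suc k) L (λ w → g (w ++ acc)) ∎

-- Removing an element from a list of distinct values

AllPairs-resp-⊆ : {R : X → X → Set} {xs ys : List X} → xs ⊆ ys → AllPairs R ys → AllPairs R xs
AllPairs-resp-⊆ []         []         = []
AllPairs-resp-⊆ (y ∷ʳ xs⊆ys) (_ ∷ Rys) = AllPairs-resp-⊆ xs⊆ys Rys
AllPairs-resp-⊆ (refl ∷ xs⊆ys) (Ry ∷ Rys) = All-resp-⊆ xs⊆ys Ry ∷ AllPairs-resp-⊆ xs⊆ys Rys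

remove : ℕ → List ℕ → List ℕ
remove x []       = []
remove x (y ∷ ys) with x ≟ y
... | yes _ = ys
... | no  _ = y ∷ remove x ys

remove-head : ∀ x ys → remove x (x ∷ ys) ≡ ys
remove-head x ys with x ≟ x
... | yes _   = refl
... | no  x≢x = ⊥-elim (x≢x refl)

remove-∷-≢ : ∀ {x y} ys → x ≢ y → remove x (y ∷ ys) ≡ y ∷ remove x ys
remove-∷-≢ {x} {y} ys x≢y with x ≟ y
... | yes x≡y = ⊥-elim (x≢y x≡y)
... | no  _   = refl

remove-⊆ : ∀ x ys → remove x ys ⊆ ys
remove-⊆ x []       = []
remove-⊆ x (y ∷ ys) with x ≟ y
... | yes _ = y ∷ʳ ⊆-refl
... | no  _ = refl ∷ remove-⊆ x ys

length-remove : ∀ {x} ys → x ∈ ys → suc (length (remove x ys)) ≡ length ys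
length-remove {x} (y ∷ ys) x∈ with x ≟ y
... | yes _ = refl
length-remove {x} (y ∷ ys) (here x≡y)  | no x≢y = ⊥-elim (x≢y x≡y)
length-remove {x} (y ∷ ys) (there x∈ys) | no _  = cong suc (length-remove ys x∈ys)

remove-∉ : ∀ x {ys} → Unique ys → x ∉ remove x ys
remove-∉ x []                 ()
remove-∉ x {y ∷ ys} (y∉ys ∷ uys) x∈ with x ≟ y
remove-∉ x {y ∷ ys} (y∉ys ∷ uys) x∈          | yes refl = All.All¬⇒¬Any y∉ys x∈
remove-∉ x {y ∷ ys} (y∉ys ∷ uys) (here x≡y)  | no x≢y   = x≢y x≡y
remove-∉ x {y ∷ ys} (y∉ys ∷ uys) (there x∈)  | no _     = remove-∉ x uys x∈

∑-⊆ : {U V : List X} {f : X → ℤ} → Unique U → V ⊆ U →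
      (∀ x → x ∈ U → x ∉ V → f x ≡ + 0) → ∑ U f ≡ ∑ V f
∑-⊆             []         []          vanish = refl
∑-⊆ {f = f} (u∉U ∷ uU) (refl ∷ V⊆U) vanish =
  cong (_+_ (f _)) (∑-⊆ uU V⊆U (λ x x∈U x∉V → vanish x (there x∈U) λ
    { (here refl) → All.All¬⇒¬Any u∉U x∈U
    ; (there x∈V) → x∉V x∈V }))
∑-⊆ {f = f} (u∉U ∷ uU) (u ∷ʳ V⊆U)  vanish =
  trans (cong₂ _+_ (vanish u (here refl) (All.All¬⇒¬Any u∉U ∘ Any-resp-⊆ V⊆U))
                   (∑-⊆ uU V⊆U (λ x → vanish x ∘ there)))
        (ℤ.+-identityˡ _)

-- Sums over sublists

∑Sublists : List X → (List X → ℤ) → ℤ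
∑Sublists []       f = f []
∑Sublists (v ∷ vs) f = ∑Sublists vs (λ T → f (v ∷ T)) + ∑Sublists vs f

∑ProperSublists : List X → (List X → ℤ) → ℤ
∑ProperSublists []       f = + 0
∑ProperSublists (v ∷ vs) f = ∑ProperSublists vs (λ T → f (v ∷ T)) + ∑Sublists vs f

∑Sublists-cong : ∀ (V : List X) {f g : List X → ℤ} → (∀ T → T ⊆ V → f T ≡ g T) → ∑Sublists V f ≡ ∑Sublists V g
∑Sublists-cong []       f≡g = f≡g [] []
∑Sublists-cong (v ∷ vs) f≡g =
  cong₂ _+_ (∑Sublists-cong vs (λ T T⊆ → f≡g (v ∷ T) (refl ∷ T⊆)))
            (∑Sublists-cong vs (λ T T⊆ → f≡g T (v ∷ʳ T⊆)))

∑ProperSublists-cong : ∀ (V : List X) {f g : List X → ℤ} →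
                       (∀ T → T ⊆ V → length T < length V → f T ≡ g T) → ∑ProperSublists V f ≡ ∑ProperSublists V g
∑ProperSublists-cong []       f≡g = refl
∑ProperSublists-cong (v ∷ vs) f≡g =
  cong₂ _+_ (∑ProperSublists-cong vs (λ T T⊆ |T|< → f≡g (v ∷ T) (refl ∷ T⊆) (s≤s |T|<)))
            (∑Sublists-cong vs (λ T T⊆ → f≡g T (v ∷ʳ T⊆) (s≤s (length-mono-≤ T⊆))))

∑Sublists-split : ∀ (V : List X) (f : List X → ℤ) → ∑Sublists V f ≡ f V + ∑ProperSublists V f
∑Sublists-split []       f = sym (ℤ.+-identityʳ _)
∑Sublists-split (v ∷ vs) f = begin
  ∑Sublists vs (λ T → f (v ∷ T)) + ∑Sublists vs f
    ≡⟨ cong (_+ ∑Sublists vs f) (∑Sublists-split vs (λ T → f (v ∷ T))) ⟩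
  f (v ∷ vs) + ∑ProperSublists vs (λ T → f (v ∷ T)) + ∑Sublists vs f
    ≡⟨ ℤ.+-assoc (f (v ∷ vs)) _ _ ⟩
  f (v ∷ vs) + (∑ProperSublists vs (λ T → f (v ∷ T)) + ∑Sublists vs f) ∎

∑Sublists-zero : ∀ (V : List X) → ∑Sublists V (λ _ → + 0) ≡ + 0
∑Sublists-zero []       = refl
∑Sublists-zero (v ∷ vs) = cong₂ _+_ (∑Sublists-zero vs) (∑Sublists-zero vs)

∑Sublists-distrib-+ : ∀ (V : List X) (f g : List X → ℤ) → ∑Sublists V (λ T → f T + g T) ≡ ∑Sublists V f + ∑Sublists V g
∑Sublists-distrib-+ []       f g = refl
∑Sublists-distrib-+ (v ∷ vs) f g =
  trans (cong₂ _+_ (∑Sublists-distrib-+ vs (λ T → f (v ∷ T)) (λ T → g (v ∷ T))) (∑Sublists-distrib-+ vs f g))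
        (interchange (∑Sublists vs (λ T → f (v ∷ T))) (∑Sublists vs (λ T → g (v ∷ T))) (∑Sublists vs f) (∑Sublists vs g))
  where
  interchange : ∀ a b c d → a + b + (c + d) ≡ a + c + (b + d)
  interchange = solve-∀

∑Sublists-*ˡ : ∀ (V : List X) c (f : List X → ℤ) → ∑Sublists V (λ T → c * f T) ≡ c * ∑Sublists V f
∑Sublists-*ˡ []       c f = refl
∑Sublists-*ˡ (v ∷ vs) c f =
  trans (cong₂ _+_ (∑Sublists-*ˡ vs c _) (∑Sublists-*ˡ vs c f)) (sym (ℤ.*-distribˡ-+ c _ _))

∑Sublists-∑ : ∀ (V : List X) (L : List Y) (f : Y → List X → ℤ) →
              ∑Sublists V (λ T → ∑[ y ∈ L ] f y T) ≡ ∑[ y ∈ L ] ∑Sublists V (f y)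
∑Sublists-∑ []       L f = refl
∑Sublists-∑ (v ∷ vs) L f = trans (cong₂ _+_ (∑Sublists-∑ vs L _) (∑Sublists-∑ vs L f)) (sym (∑-distrib-+ L _ _))

emptyIndicator : List X → ℤ
emptyIndicator []      = + 1
emptyIndicator (_ ∷ _) = + 0

∑Sublists-emptyIndicator : ∀ (V : List X) (h : List X → ℤ) → ∑Sublists V (λ T → emptyIndicator T * h T) ≡ h []
∑Sublists-emptyIndicator []       h = ℤ.*-identityˡ (h [])
∑Sublists-emptyIndicator (v ∷ vs) h =
  trans (cong (_+ ∑Sublists vs (λ T → emptyIndicator T * h T)) (∑Sublists-zero vs))
        (trans (ℤ.+-identityˡ _) (∑Sublists-emptyIndicator vs h))

∑Sublists-∑-remove : ∀ V → Unique V → (g : ℕ → List ℕ → ℤ) →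
                     ∑Sublists V (λ T → ∑[ x ∈ T ] g x (remove x T)) ≡ ∑[ x ∈ V ] ∑Sublists (remove x V) (g x)
∑Sublists-∑-remove []       []                  g = refl
∑Sublists-∑-remove (v ∷ vs) (v∉vs ∷ uvs) g = begin
  ∑Sublists vs (λ T → ∑[ x ∈ v ∷ T ] g x (remove x (v ∷ T))) + rest
    ≡⟨ cong (_+ rest) head-split ⟩
  ∑Sublists vs (g v) + ∑Sublists vs (λ T → ∑[ x ∈ T ] g x (v ∷ remove x T)) + rest
    ≡⟨ cong₂ (λ u w → ∑Sublists vs (g v) + u + w) (∑Sublists-∑-remove vs uvs (λ x S → g x (v ∷ S)))
                                                  (∑Sublists-∑-remove vs uvs g) ⟩
  ∑Sublists vs (g v) + ∑[ x ∈ vs ] ∑Sublists (remove x vs) (λ S → g x (v ∷ S))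
                     + ∑[ x ∈ vs ] ∑Sublists (remove x vs) (g x)
    ≡⟨ trans (ℤ.+-assoc (∑Sublists vs (g v)) _ _) (cong (_+_ (∑Sublists vs (g v))) (sym (∑-distrib-+ vs _ _))) ⟩
  ∑Sublists vs (g v) + ∑[ x ∈ vs ] ∑Sublists (v ∷ remove x vs) (g x)
    ≡⟨ cong₂ _+_ (cong (λ S → ∑Sublists S (g v)) (sym (remove-head v vs)))
                 (∑-cong-∈ vs (λ x x∈ → cong (λ S → ∑Sublists S (g x)) (sym (remove-∷-≢ vs (v≢ ⊆-refl x∈))))) ⟩
  ∑[ x ∈ v ∷ vs ] ∑Sublists (remove x (v ∷ vs)) (g x) ∎
  where
  rest = ∑Sublists vs (λ T → ∑[ x ∈ T ] g x (remove x T))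
  v≢ : ∀ {x T} → T ⊆ vs → x ∈ T → x ≢ v
  v≢ T⊆ x∈ refl = All.All¬⇒¬Any v∉vs (Any-resp-⊆ T⊆ x∈)
  head-split : ∑Sublists vs (λ T → ∑[ x ∈ v ∷ T ] g x (remove x (v ∷ T)))
             ≡ ∑Sublists vs (g v) + ∑Sublists vs (λ T → ∑[ x ∈ T ] g x (v ∷ remove x T))
  head-split = trans (∑Sublists-cong vs (λ T T⊆ → cong₂ _+_ (cong (g v) (remove-head v T))
                                                (∑-cong-∈ T (λ x x∈ → cong (g x) (remove-∷-≢ T (v≢ T⊆ x∈))))))
                     (∑Sublists-distrib-+ vs (g v) _)

binomialSum : ℕ → (ℕ → ℤ) → ℤ
binomialSum n h = ∑[ k ∈ upTo (suc n) ] (+ (n C k) * h k)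

binomialSum-suc : ∀ n (h : ℕ → ℤ) → binomialSum (suc n) h ≡ binomialSum n (h ∘ suc) + binomialSum n h
binomialSum-suc n h = begin
  binomialSum (suc n) h
    ≡⟨ ∑-upTo-suc (suc n) (λ k → + (suc n C k) * h k) ⟩
  + 1 * h 0 + (∑[ k ∈ upTo (suc n) ] (+ (suc n C suc k) * h (suc k)))
    ≡⟨ cong (_+_ (+ 1 * h 0)) (trans (∑-cong (upTo (suc n)) pascal)
                                     (∑-distrib-+ (upTo (suc n)) (λ k → + (n C k) * h (suc k)) (λ k → + (n C suc k) * h (suc k)))) ⟩
  + 1 * h 0 + (binomialSum n (h ∘ suc) + ∑[ k ∈ upTo (suc n) ] (+ (n C suc k) * h (suc k)))
    ≡⟨ cong (λ s → + 1 * h 0 + (binomialSum n (h ∘ suc) + s))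
            (∑-upTo-last n (λ k → + (n C suc k) * h (suc k)) top-vanishes) ⟩
  + 1 * h 0 + (binomialSum n (h ∘ suc) + ∑[ k ∈ upTo n ] (+ (n C suc k) * h (suc k)))
    ≡⟨ shuffle (+ 1 * h 0) (binomialSum n (h ∘ suc)) (∑[ k ∈ upTo n ] (+ (n C suc k) * h (suc k))) ⟩
  binomialSum n (h ∘ suc) + (+ 1 * h 0 + (∑[ k ∈ upTo n ] (+ (n C suc k) * h (suc k))))
    ≡⟨ cong (_+_ (binomialSum n (h ∘ suc))) (∑-upTo-suc n (λ k → + (n C k) * h k)) ⟨
  binomialSum n (h ∘ suc) + binomialSum n h ∎
  where
  pascal : ∀ k → + (suc n C suc k) * h (suc k) ≡ + (n C k) * h (suc k) + + (n C suc k) * h (suc k)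
  pascal k = trans (cong (λ c → + c * h (suc k)) (sym (nCk+nC[k+1]≡[n+1]C[k+1] n k)))
                   (ℤ.*-distribʳ-+ (h (suc k)) (+ (n C k)) (+ (n C suc k)))
  top-vanishes : + (n C suc n) * h (suc n) ≡ + 0
  top-vanishes = cong (λ c → + c * h (suc n)) (k>n⇒nCk≡0 (ℕ.n<1+n n))
  shuffle : ∀ a b c → a + (b + c) ≡ b + (a + c)
  shuffle = solve-∀

∑Sublists-length : ∀ (V : List X) (h : ℕ → ℤ) → ∑Sublists V (h ∘ length) ≡ binomialSum (length V) h
∑Sublists-length []       h = sym (trans (ℤ.+-identityʳ _) (ℤ.*-identityˡ (h 0)))
∑Sublists-length (v ∷ vs) h =
  trans (cong₂ _+_ (∑Sublists-length vs (h ∘ suc)) (∑Sublists-length vs h)) (sym (binomialSum-suc (length vs) h))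

∑ProperSublists-length : ∀ (V : List X) (h : ℕ → ℤ) →
                         ∑ProperSublists V (h ∘ length) ≡ binomialSum (length V) h - h (length V)
∑ProperSublists-length V h = begin
  ∑ProperSublists V (h ∘ length)                                   ≡⟨ add-sub (h (length V)) _ ⟩
  h (length V) + ∑ProperSublists V (h ∘ length) - h (length V)     ≡⟨ cong (_- h (length V)) (∑Sublists-split V (h ∘ length)) ⟨
  ∑Sublists V (h ∘ length) - h (length V)                          ≡⟨ cong (_- h (length V)) (∑Sublists-length V h) ⟩
  binomialSum (length V) h - h (length V)                          ∎
  where
  add-sub : ∀ x y → y ≡ x + y - x
  add-sub = solve-∀

-- Words covering a list of values

¬T⇒≡false : ∀ {b} → ¬ T b → b ≡ false
¬T⇒≡false {false} _  = refl
¬T⇒≡false {true}  ¬t = ⊥-elim (¬t _)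

≡ᵇ-refl : ∀ m → (m ≡ᵇ m) ≡ true
≡ᵇ-refl m = Equivalence.to T-≡ (ℕ.≡⇒≡ᵇ m m refl)

≢⇒≡ᵇ-false : ∀ {m n} → m ≢ n → (m ≡ᵇ n) ≡ false
≢⇒≡ᵇ-false {m} {n} m≢n = ¬T⇒≡false (m≢n ∘ ℕ.≡ᵇ⇒≡ m n)

<⇒<ᵇ-true : ∀ {m n} → m < n → (m <ᵇ n) ≡ true
<⇒<ᵇ-true m<n = Equivalence.to T-≡ (ℕ.<⇒<ᵇ m<n)

>⇒<ᵇ-false : ∀ {m n} → n < m → (m <ᵇ n) ≡ false
>⇒<ᵇ-false {m} {n} n<m = ¬T⇒≡false (ℕ.<-asym n<m ∘ ℕ.<ᵇ⇒< m n)

occurs : ℕ → List ColInt → Bool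
occurs v w = any (λ q → v ≡ᵇ proj₁ q) w

covers : List ℕ → List ColInt → Bool
covers V w = all (λ v → occurs v w) V

covers-∷-∉ : ∀ {x} c w V → x ∉ V → covers V ((x , c) ∷ w) ≡ covers V w
covers-∷-∉     c w []       x∉V = refl
covers-∷-∉ {x} c w (v ∷ vs) x∉V
  rewrite ≢⇒≡ᵇ-false {v} {x} (λ v≡x → x∉V (here (sym v≡x)))
  = cong (occurs v w ∧_) (covers-∷-∉ c w vs (x∉V ∘ there))

covers-∷-∈ : ∀ {x} c w V → Unique V → x ∈ V → covers V ((x , c) ∷ w) ≡ covers (remove x V) w
covers-∷-∈ {x} c w (v ∷ vs) (v∉vs ∷ uvs) x∈V with x ≟ v
covers-∷-∈ {x} c w (x ∷ vs) (x∉vs ∷ uvs) x∈V          | yes refl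
  rewrite ≡ᵇ-refl x = covers-∷-∉ c w vs (All.All¬⇒¬Any x∉vs)
covers-∷-∈ {x} c w (v ∷ vs) (v∉vs ∷ uvs) (here x≡v)   | no x≢v = ⊥-elim (x≢v x≡v)
covers-∷-∈ {x} c w (v ∷ vs) (v∉vs ∷ uvs) (there x∈vs) | no x≢v
  rewrite ≢⇒≡ᵇ-false {v} {x} (x≢v ∘ sym) = cong (occurs v w ∧_) (covers-∷-∈ c w vs uvs x∈vs)

deleteOccurrence : ℕ → List ColInt → List ColInt
deleteOccurrence v []      = []
deleteOccurrence v (q ∷ w) = if v ≡ᵇ proj₁ q then w else q ∷ deleteOccurrence v w

length-deleteOccurrence : ∀ v w → T (occurs v w) → suc (length (deleteOccurrence v w)) ≡ length w
length-deleteOccurrence v (q ∷ w) v∈w with v ≡ᵇ proj₁ q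
... | true  = refl
... | false = cong suc (length-deleteOccurrence v w v∈w)

occurs-deleteOccurrence : ∀ v u w → u ≢ v → T (occurs u w) → T (occurs u (deleteOccurrence v w))
occurs-deleteOccurrence v u (q ∷ w) u≢v u∈w with v ≡ᵇ proj₁ q in v≡q
... | false with u ≡ᵇ proj₁ q
...   | true  = _
...   | false = occurs-deleteOccurrence v u w u≢v u∈w
occurs-deleteOccurrence v u (q ∷ w) u≢v u∈w | true with u ≡ᵇ proj₁ q in u≡q
...   | true  = ⊥-elim (u≢v (trans (ℕ.≡ᵇ⇒≡ u (proj₁ q) (subst T (sym u≡q) _))
                                  (sym (ℕ.≡ᵇ⇒≡ v (proj₁ q) (subst T (sym v≡q) _)))))
...   | false = u∈w

covers⇒length≤ : ∀ V w → Unique V → T (covers V w) → length V ≤ length w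
covers⇒length≤ []       w []           _   = z≤n
covers⇒length≤ (v ∷ vs) w (v∉vs ∷ uvs) cov =
  subst (suc (length vs) ≤_) (length-deleteOccurrence v w v∈w)
        (s≤s (covers⇒length≤ vs (deleteOccurrence v w) uvs (coversRest vs v∉vs vs-covered)))
  where
  v∈w        = proj₁ (Equivalence.to T-∧ cov)
  vs-covered = proj₂ (Equivalence.to T-∧ cov)
  coversRest : ∀ us → All (λ u → v ≢ u) us → T (covers us w) → T (covers us (deleteOccurrence v w))
  coversRest []       []              _   = _
  coversRest (u ∷ us) (v≢u ∷ v∉us) cov′ =
    Equivalence.from T-∧ ( occurs-deleteOccurrence v u w (v≢u ∘ sym) (proj₁ (Equivalence.to T-∧ cov′))
                         , coversRest us v∉us (proj₂ (Equivalence.to T-∧ cov′)))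

oneTo : ℕ → List ℕ
oneTo n = map suc (upTo n)

length-oneTo : ∀ n → length (oneTo n) ≡ n
length-oneTo n = trans (length-map suc (upTo n)) (length-upTo n)

oneTo-increasing : ∀ n → AllPairs _<_ (oneTo n)
oneTo-increasing n = subst (AllPairs _<_) (sym (map-upTo suc n)) (AllPairs.applyUpTo⁺₁ suc n (λ i<j _ → s≤s i<j))

oneTo-positive : ∀ n → All (0 <_) (oneTo n)
oneTo-positive n = subst (All (0 <_)) (sym (map-upTo suc n)) (All.applyUpTo⁺₂ suc n (λ _ → s≤s z≤n))

increasing⇒unique : {V : List ℕ} → AllPairs _<_ V → Unique V
increasing⇒unique = AllPairs.map ℕ.<⇒≢

egfProd-as-binomialSum : ∀ (f g : ℕ → ℤ) n → egfProd f g n ≡ binomialSum n (λ k → f k * g (n ∸ k))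
egfProd-as-binomialSum f g n = ∑-cong (upTo (suc n)) (λ k → ℤ.*-assoc (+ (n C k)) (f k) (g (n ∸ k)))

egfProd-zeroʳ : ∀ (f g : ℕ → ℤ) n → (∀ j → g j ≡ + 0) → egfProd f g n ≡ + 0
egfProd-zeroʳ f g n g≡0 = trans (∑-cong (upTo (suc n)) vanish) (∑-zero (upTo (suc n)))
  where
  vanish : ∀ k → + (n C k) * f k * g (n ∸ k) ≡ + 0
  vanish k = trans (cong (+ (n C k) * f k *_) (g≡0 (n ∸ k))) (ℤ.*-zeroʳ (+ (n C k) * f k))

denomCoeff-at-one : ∀ r a j → denomCoeff r (+ 1) a j ≡ + 0
denomCoeff-at-one r a zero    = refl
denomCoeff-at-one r a (suc j) rewrite ℤ.*-zeroʳ (+ 1 + a * qint (r ∸ 1) a) = refl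

allAbove : ℕ → List ℕ → ℤ
allAbove z []       = + 1
allAbove z (y ∷ ys) = if z <ᵇ y then allAbove z ys else + 0

countBelow : ℕ → List ℕ → ℕ
countBelow z []       = 0
countBelow z (y ∷ ys) = if y <ᵇ z then suc (countBelow z ys) else countBelow z ys

allAbove-all : ∀ z V → All (z <_) V → allAbove z V ≡ + 1
allAbove-all z []       []             = refl
allAbove-all z (y ∷ ys) (z<y ∷ z<ys) rewrite <⇒<ᵇ-true z<y = allAbove-all z ys z<ys

countBelow-none : ∀ z V → All (z <_) V → countBelow z V ≡ 0
countBelow-none z []       []             = refl
countBelow-none z (y ∷ ys) (z<y ∷ z<ys) rewrite >⇒<ᵇ-false z<y = countBelow-none z ys z<ys

-- Colored permutations

module Colored (m : ℕ) (t a : ℤ) where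

  r : ℕ
  r = suc m

  stepWeight : ColInt → ColInt → ℤ
  stepWeight p q = if q <ᶜ p then t else + 1

  weight : ColInt → List ColInt → ℤ
  weight p w = t ^ descents p w * a ^ col w

  weight-∷ : ∀ p x c w → weight p ((x , c) ∷ w) ≡ stepWeight p (x , c) * a ^ c * weight (x , c) w
  weight-∷ p x c w
    rewrite ℤ.^-distribˡ-+-* t (if (x , c) <ᶜ p then 1 else 0) (descents (x , c) w)
          | ℤ.^-distribˡ-+-* a c (col w)
    with (x , c) <ᶜ p
  ... | true  = descent t (t ^ descents (x , c) w) (a ^ c) (a ^ col w)
    where
    descent : ∀ t D A B → (t * + 1) * D * (A * B) ≡ t * A * (D * B)
    descent = solve-∀
  ... | false = ascent (t ^ descents (x , c) w) (a ^ c) (a ^ col w)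
    where
    ascent : ∀ D A B → + 1 * D * (A * B) ≡ + 1 * A * (D * B)
    ascent = solve-∀

  extend : ColInt → ℕ → (ColInt → ℤ) → ℤ
  extend p x h = ∑[ c ∈ upTo r ] (stepWeight p (x , c) * a ^ c * h (x , c))

  extend-cong : ∀ p x (h h′ : ColInt → ℤ) → (∀ c → h (x , c) ≡ h′ (x , c)) → extend p x h ≡ extend p x h′
  extend-cong p x h h′ h≡h′ = ∑-cong (upTo r) (λ c → cong (stepWeight p (x , c) * a ^ c *_) (h≡h′ c))

  extend-*ˡ : ∀ p x k h → extend p x (λ q → k * h q) ≡ k * extend p x h
  extend-*ˡ p x k h = trans (∑-cong (upTo r) (λ c → reorder (stepWeight p (x , c)) (a ^ c) k (h (x , c))))
                            (∑-*ˡ (upTo r) k _)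
    where
    reorder : ∀ s A k H → s * A * (k * H) ≡ k * (s * A * H)
    reorder = solve-∀

  arrSum : ℕ → List ℕ → ColInt → ℤ
  arrSum zero    V p = + 1
  arrSum (suc k) V p = ∑[ x ∈ V ] extend p x (arrSum k (remove x V))

  coveringWeight : List ℕ → ColInt → List ColInt → ℤ
  coveringWeight V p w = if covers V w then weight p w else + 0

  coveringWeight-∷-∈ : ∀ {x} V p c w → Unique V → x ∈ V →
    coveringWeight V p ((x , c) ∷ w) ≡ stepWeight p (x , c) * a ^ c * coveringWeight (remove x V) (x , c) w
  coveringWeight-∷-∈ {x} V p c w uV x∈V rewrite covers-∷-∈ c w V uV x∈V with covers (remove x V) w
  ... | true  = weight-∷ p x c w
  ... | false = sym (ℤ.*-zeroʳ (stepWeight p (x , c) * a ^ c))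

  coveringWeight-∷-∉ : ∀ {x} V p c w → Unique V → x ∉ V → length w < length V →
    coveringWeight V p ((x , c) ∷ w) ≡ + 0
  coveringWeight-∷-∉ {x} V p c w uV x∉V short rewrite covers-∷-∉ c w V x∉V with covers V w in cov
  ... | true  = ⊥-elim (ℕ.<⇒≱ short (covers⇒length≤ V w uV (Equivalence.from T-≡ cov)))
  ... | false = refl

  ∑Words-coveringWeight : ∀ N k V p → length V ≡ k → Unique V → V ⊆ oneTo N →
                          ∑Words k (letters r N) (coveringWeight V p) ≡ arrSum k V p
  ∑Words-coveringWeight N zero    []       p _ _  _ = refl
  ∑Words-coveringWeight N (suc k) V        p |V| uV V⊆ = begin
    ∑[ q ∈ letters r N ] ∑Words k L (λ w → coveringWeight V p (q ∷ w))
      ≡⟨ ∑-cartesianProduct (oneTo N) (upTo r) (λ q → ∑Words k L (λ w → coveringWeight V p (q ∷ w))) ⟩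
    ∑[ x ∈ oneTo N ] ∑[ c ∈ upTo r ] ∑Words k L (λ w → coveringWeight V p ((x , c) ∷ w))
      ≡⟨ ∑-⊆ (increasing⇒unique (oneTo-increasing N)) V⊆ absent ⟩
    ∑[ x ∈ V ] ∑[ c ∈ upTo r ] ∑Words k L (λ w → coveringWeight V p ((x , c) ∷ w))
      ≡⟨ ∑-cong-∈ V present ⟩
    ∑[ x ∈ V ] extend p x (arrSum k (remove x V)) ∎
    where
    L = letters r N
    present : ∀ x → x ∈ V → ∑[ c ∈ upTo r ] ∑Words k L (λ w → coveringWeight V p ((x , c) ∷ w))
                          ≡ extend p x (arrSum k (remove x V))
    present x x∈V = ∑-cong (upTo r) λ c → begin
      ∑Words k L (λ w → coveringWeight V p ((x , c) ∷ w))
        ≡⟨ ∑Words-cong k L (λ w _ → coveringWeight-∷-∈ V p c w uV x∈V) ⟩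
      ∑Words k L (λ w → stepWeight p (x , c) * a ^ c * coveringWeight (remove x V) (x , c) w)
        ≡⟨ ∑Words-*ˡ k L (stepWeight p (x , c) * a ^ c) (coveringWeight (remove x V) (x , c)) ⟩
      stepWeight p (x , c) * a ^ c * ∑Words k L (coveringWeight (remove x V) (x , c))
        ≡⟨ cong (stepWeight p (x , c) * a ^ c *_)
                (∑Words-coveringWeight N k (remove x V) (x , c) (ℕ.suc-injective (trans (length-remove V x∈V) |V|))
                                       (AllPairs-resp-⊆ (remove-⊆ x V) uV) (⊆-trans (remove-⊆ x V) V⊆)) ⟩
      stepWeight p (x , c) * a ^ c * arrSum k (remove x V) (x , c) ∎
    absent : ∀ x → x ∈ oneTo N → x ∉ V → ∑[ c ∈ upTo r ] ∑Words k L (λ w → coveringWeight V p ((x , c) ∷ w)) ≡ + 0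
    absent x _ x∉V = trans (∑-cong (upTo r) (λ c → trans (∑Words-cong k L (λ w |w| → vanish c w |w|)) (∑Words-zero k L)))
                           (∑-zero (upTo r))
      where
      vanish : ∀ c w → length w ≡ k → coveringWeight V p ((x , c) ∷ w) ≡ + 0
      vanish c w |w| = coveringWeight-∷-∉ V p c w uV x∉V (subst₂ _<_ (sym |w|) (sym |V|) (ℕ.n<1+n k))

  F≡arrSum : ∀ n → F r n t a ≡ arrSum n (oneTo n) (0 , 0)
  F≡arrSum n = begin
    F r n t a
      ≡⟨ ∑-filterᵇ (isPermWord n) (words n L []) (λ γ → t ^ desG γ * a ^ col γ) ⟩
    ∑ (words n L []) (coveringWeight (oneTo n) (0 , 0))
      ≡⟨ ∑-words n L [] (coveringWeight (oneTo n) (0 , 0)) ⟩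
    ∑Words n L (λ w → coveringWeight (oneTo n) (0 , 0) (w ++ []))
      ≡⟨ ∑Words-cong n L (λ w _ → cong (coveringWeight (oneTo n) (0 , 0)) (++-identityʳ w)) ⟩
    ∑Words n L (coveringWeight (oneTo n) (0 , 0))
      ≡⟨ ∑Words-coveringWeight n n (oneTo n) (0 , 0) (length-oneTo n) (increasing⇒unique (oneTo-increasing n)) ⊆-refl ⟩
    arrSum n (oneTo n) (0 , 0) ∎
    where
    L = letters r n

  -- The generalised identity

  τ : ℤ
  τ = + 1 - t

  R : ℤ
  R = qint r a

  D : ℕ → ℤ
  D = denomCoeff r t a

  D-suc : ∀ j → D (suc j) ≡ + 0 - t * (R ^ suc j * τ ^ suc j)
  D-suc j = cong (λ b → + 0 - t * b) (trans (cong (λ R′ → (R′ * τ) ^ suc j) (sym (qint-suc m a))) (^-distribʳ-* R τ (suc j)))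

  -- Σ t^des a^col over the colored permutations of V, with γ(0) := p.
  permSum : List ℕ → ColInt → ℤ
  permSum V p = arrSum (length V) V p

  permSum-expand : ∀ T p → permSum T p ≡ emptyIndicator T + ∑[ x ∈ T ] extend p x (permSum (remove x T))
  permSum-expand []      p = refl
  permSum-expand (y ∷ T) p = trans (∑-cong-∈ (y ∷ T) shrink) (sym (ℤ.+-identityˡ _))
    where
    shrink : ∀ x → x ∈ y ∷ T → extend p x (arrSum (length T) (remove x (y ∷ T))) ≡ extend p x (permSum (remove x (y ∷ T)))
    shrink x x∈ = extend-cong p x (arrSum (length T) (remove x (y ∷ T))) (permSum (remove x (y ∷ T))) λ c →
      cong (λ k → arrSum k (remove x (y ∷ T)) (x , c)) (ℕ.suc-injective (sym (length-remove (y ∷ T) x∈)))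

  Φ : List ℕ → ColInt → ℤ
  Φ V (z , zero)  = allAbove z V
  Φ V (z , suc _) = R ^ countBelow z V

  extendColored : ColInt → ℕ → (ColInt → ℤ) → ℤ
  extendColored p x h = ∑[ c ∈ upTo m ] (stepWeight p (x , suc c) * a ^ suc c * h (x , suc c))

  extend-split : ∀ p x h → extend p x h ≡ stepWeight p (x , 0) * + 1 * h (x , 0) + extendColored p x h
  extend-split p x h = ∑-upTo-suc m (λ c → stepWeight p (x , c) * a ^ c * h (x , c))

  uncoloredSum : List ℕ → ColInt → ℤ
  uncoloredSum V p = ∑[ x ∈ V ] (stepWeight p (x , 0) * + 1 * Φ (remove x V) (x , 0))

  coloredSum : List ℕ → ColInt → ℤ
  coloredSum V p = ∑[ x ∈ V ] extendColored p x (Φ (remove x V))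

  uncoloredSum-∷ : ∀ v V p → AllPairs _<_ (v ∷ V) → uncoloredSum (v ∷ V) p ≡ stepWeight p (v , 0)
  uncoloredSum-∷ v V p (v<V ∷ _) = trans (cong₂ _+_ head tail) (ℤ.+-identityʳ _)
    where
    head : stepWeight p (v , 0) * + 1 * Φ (remove v (v ∷ V)) (v , 0) ≡ stepWeight p (v , 0)
    head rewrite remove-head v V | allAbove-all v V v<V = trans (ℤ.*-identityʳ _) (ℤ.*-identityʳ _)
    tail : ∑[ x ∈ V ] (stepWeight p (x , 0) * + 1 * Φ (remove x (v ∷ V)) (x , 0)) ≡ + 0
    tail = trans (∑-cong-∈ V vanish) (∑-zero V)
      where
      vanish : ∀ x → x ∈ V → stepWeight p (x , 0) * + 1 * Φ (remove x (v ∷ V)) (x , 0) ≡ + 0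
      vanish x x∈V rewrite remove-∷-≢ V (ℕ.<⇒≢ (All.lookup v<V x∈V) ∘ sym) | >⇒<ᵇ-false (All.lookup v<V x∈V)
        = ℤ.*-zeroʳ (stepWeight p (x , 0) * + 1)

  ∑-constant-weight : ∀ p v w → (∀ c → stepWeight p (v , suc c) ≡ w) →
                      ∑[ c ∈ upTo m ] (stepWeight p (v , suc c) * a ^ suc c) ≡ w * (a * qint m a)
  ∑-constant-weight p v w const = trans (∑-cong (upTo m) (λ c → cong (_* a ^ suc c) (const c)))
                                        (trans (∑-*ˡ (upTo m) w (λ c → a ^ suc c)) (cong (w *_) (∑-*ˡ (upTo m) a (a ^_))))

  coloredSum-∷ : ∀ v V p → AllPairs _<_ (v ∷ V) →
                 coloredSum (v ∷ V) p ≡ ∑[ c ∈ upTo m ] (stepWeight p (v , suc c) * a ^ suc c) + R * coloredSum V p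
  coloredSum-∷ v V p (v<V ∷ _) = cong₂ _+_ head tail
    where
    head : extendColored p v (Φ (remove v (v ∷ V))) ≡ ∑[ c ∈ upTo m ] (stepWeight p (v , suc c) * a ^ suc c)
    head rewrite remove-head v V | countBelow-none v V v<V = ∑-cong (upTo m) (λ c → ℤ.*-identityʳ _)
    tail : ∑[ x ∈ V ] extendColored p x (Φ (remove x (v ∷ V))) ≡ R * coloredSum V p
    tail = trans (∑-cong-∈ V (λ x x∈V → trans (∑-cong (upTo m) (extra-factor x x∈V)) (∑-*ˡ (upTo m) R _))) (∑-*ˡ V R _)
      where
      extra-factor : ∀ x → x ∈ V → ∀ c → stepWeight p (x , suc c) * a ^ suc c * Φ (remove x (v ∷ V)) (x , suc c)
                                        ≡ R * (stepWeight p (x , suc c) * a ^ suc c * Φ (remove x V) (x , suc c))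
      extra-factor x x∈V c rewrite remove-∷-≢ V (ℕ.<⇒≢ (All.lookup v<V x∈V) ∘ sym) | <⇒<ᵇ-true (All.lookup v<V x∈V)
        = reorder (stepWeight p (x , suc c) * a ^ suc c) R (R ^ countBelow x (remove x V))
        where
        reorder : ∀ s R Y → s * (R * Y) ≡ R * (s * Y)
        reorder = solve-∀

  coloredSum-uncolored : ∀ z V → AllPairs _<_ V → coloredSum V (z , 0) ≡ t * (R ^ length V - + 1)
  coloredSum-uncolored z []       []             = sym (ℤ.*-zeroʳ t)
  coloredSum-uncolored z (v ∷ V) inc@(_ ∷ incV) = begin
    coloredSum (v ∷ V) (z , 0)
      ≡⟨ coloredSum-∷ v V (z , 0) inc ⟩
    ∑[ c ∈ upTo m ] (t * a ^ suc c) + R * coloredSum V (z , 0)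
      ≡⟨ cong₂ (λ s k → s + R * k) (∑-constant-weight (z , 0) v t (λ _ → refl)) (coloredSum-uncolored z V incV) ⟩
    t * (a * qint m a) + R * (t * (R ^ length V - + 1))
      ≡⟨ cong (λ R′ → t * (a * qint m a) + R′ * (t * (R ^ length V - + 1))) (qint-suc m a) ⟩
    t * (a * qint m a) + (+ 1 + a * qint m a) * (t * (R ^ length V - + 1))
      ≡⟨ identity t (a * qint m a) (R ^ length V) ⟩
    t * ((+ 1 + a * qint m a) * R ^ length V - + 1)
      ≡⟨ cong (λ R′ → t * (R′ * R ^ length V - + 1)) (qint-suc m a) ⟨
    t * (R ^ length (v ∷ V) - + 1) ∎
    where
    identity : ∀ t A X → t * A + (+ 1 + A) * (t * (X - + 1)) ≡ t * ((+ 1 + A) * X - + 1)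
    identity = solve-∀

  stepWeight-colored : ∀ {x z} c e → x ≢ z → stepWeight (z , suc e) (x , suc c) ≡ (if z <ᵇ x then t else + 1)
  stepWeight-colored {x} {z} c e x≢z rewrite ≢⇒≡ᵇ-false x≢z with z <ᵇ x
  ... | true  = refl
  ... | false = refl

  coloredSum-colored : ∀ z e V → AllPairs _<_ V → z ∉ V →
                       coloredSum V (z , suc e) ≡ τ * R ^ countBelow z V + t * R ^ length V - + 1
  coloredSum-colored z e []      []             z∉V = identity t
    where
    identity : ∀ t → + 0 ≡ (+ 1 - t) * + 1 + t * + 1 - + 1
    identity = solve-∀
  coloredSum-colored z e (v ∷ V) inc@(v<V ∷ incV) z∉V = begin
    coloredSum (v ∷ V) (z , suc e)
      ≡⟨ coloredSum-∷ v V (z , suc e) inc ⟩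
    ∑[ c ∈ upTo m ] (stepWeight (z , suc e) (v , suc c) * a ^ suc c) + R * coloredSum V (z , suc e)
      ≡⟨ cong₂ (λ s k → s + R * k) (∑-constant-weight (z , suc e) v w (λ c → stepWeight-colored c e v≢z))
                                   (coloredSum-colored z e V incV (z∉V ∘ there)) ⟩
    w * A + R * (τ * R ^ countBelow z V + t * R ^ length V - + 1)
      ≡⟨ cong (λ R′ → w * A + R′ * (τ * R ^ countBelow z V + t * R ^ length V - + 1)) (qint-suc m a) ⟩
    w * A + (+ 1 + A) * (τ * R ^ countBelow z V + t * R ^ length V - + 1)
      ≡⟨ compare (ℕ.<-cmp v z) ⟩
    τ * R ^ countBelow z (v ∷ V) + t * R ^ length (v ∷ V) - + 1 ∎
    where
    A = a * qint m a
    v≢z : v ≢ z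
    v≢z v≡z = z∉V (here (sym v≡z))
    w : ℤ
    w = if z <ᵇ v then t else + 1
    compare : _ → w * A + (+ 1 + A) * (τ * R ^ countBelow z V + t * R ^ length V - + 1)
                ≡ τ * R ^ countBelow z (v ∷ V) + t * R ^ length (v ∷ V) - + 1
    compare (tri< v<z _ _) rewrite >⇒<ᵇ-false v<z | <⇒<ᵇ-true v<z
      = trans (identity t A (R ^ countBelow z V) (R ^ length V))
              (cong (λ R′ → τ * (R′ * R ^ countBelow z V) + t * (R′ * R ^ length V) - + 1) (sym (qint-suc m a)))
      where
      identity : ∀ t A Y X → + 1 * A + (+ 1 + A) * ((+ 1 - t) * Y + t * X - + 1)
                             ≡ (+ 1 - t) * ((+ 1 + A) * Y) + t * ((+ 1 + A) * X) - + 1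
      identity = solve-∀
    compare (tri≈ _ v≡z _) = ⊥-elim (v≢z v≡z)
    compare (tri> _ _ z<v) rewrite <⇒<ᵇ-true z<v | >⇒<ᵇ-false z<v
                                 | countBelow-none z V (All.map (ℕ.<-trans z<v) v<V)
      = trans (identity t A (R ^ length V)) (cong (λ R′ → τ * + 1 + t * (R′ * R ^ length V) - + 1) (sym (qint-suc m a)))
      where
      identity : ∀ t A X → t * A + (+ 1 + A) * ((+ 1 - t) * + 1 + t * X - + 1)
                           ≡ (+ 1 - t) * + 1 + t * ((+ 1 + A) * X) - + 1
      identity = solve-∀

  ∑-extend-Φ : ∀ v V p → AllPairs _<_ (v ∷ V) → proj₁ p ∉ v ∷ V →
               ∑[ x ∈ v ∷ V ] extend p x (Φ (remove x (v ∷ V))) ≡ τ * Φ (v ∷ V) p + t * R ^ length (v ∷ V)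
  ∑-extend-Φ v V p inc p∉ = begin
    ∑[ x ∈ v ∷ V ] extend p x (Φ (remove x (v ∷ V)))
      ≡⟨ ∑-cong (v ∷ V) (λ x → extend-split p x (Φ (remove x (v ∷ V)))) ⟩
    ∑[ x ∈ v ∷ V ] (stepWeight p (x , 0) * + 1 * Φ (remove x (v ∷ V)) (x , 0) + extendColored p x (Φ (remove x (v ∷ V))))
      ≡⟨ ∑-distrib-+ (v ∷ V) (λ x → stepWeight p (x , 0) * + 1 * Φ (remove x (v ∷ V)) (x , 0))
                             (λ x → extendColored p x (Φ (remove x (v ∷ V)))) ⟩
    uncoloredSum (v ∷ V) p + coloredSum (v ∷ V) p
      ≡⟨ cong (_+ coloredSum (v ∷ V) p) (uncoloredSum-∷ v V p inc) ⟩
    stepWeight p (v , 0) + coloredSum (v ∷ V) p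
      ≡⟨ byPrefix p p∉ ⟩
    τ * Φ (v ∷ V) p + t * R ^ length (v ∷ V) ∎
    where
    Rᵏ = R ^ length (v ∷ V)
    byPrefix : ∀ p → proj₁ p ∉ v ∷ V → stepWeight p (v , 0) + coloredSum (v ∷ V) p ≡ τ * Φ (v ∷ V) p + t * Rᵏ
    byPrefix (z , suc e) z∉ rewrite coloredSum-colored z e (v ∷ V) inc z∉ = identity t (R ^ countBelow z (v ∷ V)) Rᵏ
      where
      identity : ∀ t Y X → + 1 + ((+ 1 - t) * Y + t * X - + 1) ≡ (+ 1 - t) * Y + t * X
      identity = solve-∀
    byPrefix (z , zero)  z∉ rewrite coloredSum-uncolored z (v ∷ V) inc = compare (ℕ.<-cmp v z)
      where
      compare : _ → stepWeight (z , 0) (v , 0) + t * (Rᵏ - + 1) ≡ τ * allAbove z (v ∷ V) + t * Rᵏ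
      compare (tri< v<z _ _) rewrite <⇒<ᵇ-true v<z | >⇒<ᵇ-false v<z = identity t Rᵏ
        where
        identity : ∀ t X → t + t * (X - + 1) ≡ (+ 1 - t) * + 0 + t * X
        identity = solve-∀
      compare (tri≈ _ v≡z _) = ⊥-elim (z∉ (here (sym v≡z)))
      compare (tri> _ _ z<v) rewrite >⇒<ᵇ-false z<v | <⇒<ᵇ-true z<v
                                   | allAbove-all z V (All.map (ℕ.<-trans z<v) (AllPairs.head inc)) = identity t Rᵏ
        where
        identity : ∀ t X → + 1 + t * (X - + 1) ≡ (+ 1 - t) * + 1 + t * X
        identity = solve-∀

  ∑Sublists-extend : ∀ V p x (f : List ℕ → ColInt → ℤ) →
                     ∑Sublists V (λ S → extend p x (f S)) ≡ extend p x (λ q → ∑Sublists V (λ S → f S q))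
  ∑Sublists-extend V p x f = trans (∑Sublists-∑ V (upTo r) (λ c S → stepWeight p (x , c) * a ^ c * f S (x , c)))
                                   (∑-cong (upTo r) (λ c → ∑Sublists-*ˡ V (stepWeight p (x , c) * a ^ c) (λ S → f S (x , c))))

  extend-*ʳ : ∀ p x h k → extend p x h * k ≡ extend p x (λ q → h q * k)
  extend-*ʳ p x h k = trans (∑-*ʳ (upTo r) (λ c → stepWeight p (x , c) * a ^ c * h (x , c)) k)
                            (∑-cong (upTo r) (λ c → ℤ.*-assoc (stepWeight p (x , c) * a ^ c) (h (x , c)) k))

  permSum-identity : ∀ n V p → length V ≡ n → AllPairs _<_ V → proj₁ p ∉ V →
                     ∑Sublists V (λ T → permSum T p * D (n ∸ length T)) ≡ τ ^ suc n * Φ V p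
  permSum-identity zero    []      (z , zero)  _ _ _ = base t
    where
    base : ∀ t → + 1 * (+ 1 - t) ≡ (+ 1 - t) * + 1 * + 1
    base = solve-∀
  permSum-identity zero    []      (z , suc e) _ _ _ = base t
    where
    base : ∀ t → + 1 * (+ 1 - t) ≡ (+ 1 - t) * + 1 * + 1
    base = solve-∀
  permSum-identity (suc n) (v ∷ V) p |V| inc p∉ = begin
    ∑Sublists (v ∷ V) (λ T → permSum T p * D (suc n ∸ length T))
      ≡⟨ ∑Sublists-cong (v ∷ V) (λ T _ → expand T) ⟩
    ∑Sublists (v ∷ V) (λ T → emptyIndicator T * D (suc n ∸ length T) + ∑[ x ∈ T ] g x (remove x T))
      ≡⟨ ∑Sublists-distrib-+ (v ∷ V) (λ T → emptyIndicator T * D (suc n ∸ length T)) (λ T → ∑[ x ∈ T ] g x (remove x T)) ⟩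
    ∑Sublists (v ∷ V) (λ T → emptyIndicator T * D (suc n ∸ length T)) + ∑Sublists (v ∷ V) (λ T → ∑[ x ∈ T ] g x (remove x T))
      ≡⟨ cong₂ _+_ (∑Sublists-emptyIndicator (v ∷ V) (λ T → D (suc n ∸ length T)))
                   (∑Sublists-∑-remove (v ∷ V) (increasing⇒unique inc) g) ⟩
    D (suc n) + ∑[ x ∈ v ∷ V ] ∑Sublists (remove x (v ∷ V)) (g x)
      ≡⟨ cong (_+_ (D (suc n))) (trans (∑-cong-∈ (v ∷ V) recurse) (∑-*ˡ (v ∷ V) (τ ^ suc n) _)) ⟩
    D (suc n) + τ ^ suc n * ∑[ x ∈ v ∷ V ] extend p x (Φ (remove x (v ∷ V)))
      ≡⟨ cong (λ s → D (suc n) + τ ^ suc n * s) (∑-extend-Φ v V p inc p∉) ⟩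
    D (suc n) + τ ^ suc n * (τ * Φ (v ∷ V) p + t * R ^ length (v ∷ V))
      ≡⟨ cong₂ (λ d k → d + τ ^ suc n * (τ * Φ (v ∷ V) p + t * R ^ k)) (D-suc n) |V| ⟩
    + 0 - t * (R ^ suc n * τ ^ suc n) + τ ^ suc n * (τ * Φ (v ∷ V) p + t * R ^ suc n)
      ≡⟨ identity t τ (R ^ suc n) (τ ^ suc n) (Φ (v ∷ V) p) ⟩
    τ ^ suc (suc n) * Φ (v ∷ V) p ∎
    where
    g : ℕ → List ℕ → ℤ
    g x S = extend p x (λ q → permSum S q * D (n ∸ length S))

    expand : ∀ T → permSum T p * D (suc n ∸ length T)
                 ≡ emptyIndicator T * D (suc n ∸ length T) + ∑[ x ∈ T ] g x (remove x T)
    expand T = begin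
      permSum T p * d
        ≡⟨ cong (_* d) (permSum-expand T p) ⟩
      (emptyIndicator T + ∑[ x ∈ T ] extend p x (permSum (remove x T))) * d
        ≡⟨ ℤ.*-distribʳ-+ d (emptyIndicator T) _ ⟩
      emptyIndicator T * d + (∑[ x ∈ T ] extend p x (permSum (remove x T))) * d
        ≡⟨ cong (_+_ (emptyIndicator T * d)) (trans (∑-*ʳ T (λ x → extend p x (permSum (remove x T))) d) (∑-cong-∈ T shift)) ⟩
      emptyIndicator T * d + ∑[ x ∈ T ] g x (remove x T) ∎
      where
      d = D (suc n ∸ length T)
      shift : ∀ x → x ∈ T → extend p x (permSum (remove x T)) * d ≡ g x (remove x T)
      shift x x∈ = trans (extend-*ʳ p x (permSum (remove x T)) d)
                         (cong (λ j → extend p x (λ q → permSum (remove x T) q * D (suc n ∸ j))) (sym (length-remove T x∈)))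

    recurse : ∀ x → x ∈ v ∷ V → ∑Sublists (remove x (v ∷ V)) (g x) ≡ τ ^ suc n * extend p x (Φ (remove x (v ∷ V)))
    recurse x x∈ = begin
      ∑Sublists S (g x)
        ≡⟨ ∑Sublists-extend S p x (λ S′ q → permSum S′ q * D (n ∸ length S′)) ⟩
      extend p x (λ q → ∑Sublists S (λ S′ → permSum S′ q * D (n ∸ length S′)))
        ≡⟨ extend-cong p x (λ q → ∑Sublists S (λ S′ → permSum S′ q * D (n ∸ length S′))) (λ q → τ ^ suc n * Φ S q)
                       (λ c → permSum-identity n S (x , c) (ℕ.suc-injective (trans (length-remove (v ∷ V) x∈) |V|))
                                    (AllPairs-resp-⊆ (remove-⊆ x (v ∷ V)) inc) (remove-∉ x (increasing⇒unique inc))) ⟩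
      extend p x (λ q → τ ^ suc n * Φ S q)
        ≡⟨ extend-*ˡ p x (τ ^ suc n) (Φ S) ⟩
      τ ^ suc n * extend p x (Φ S) ∎
      where
      S = remove x (v ∷ V)

    identity : ∀ t τ X W P → + 0 - t * (X * W) + W * (τ * P + t * X) ≡ τ * W * P
    identity = solve-∀

  permSum-at-origin : ∀ n S → length S ≡ n → AllPairs _<_ S → All (0 <_) S →
                      ∑Sublists S (λ T → permSum T (0 , 0) * D (n ∸ length T)) ≡ τ ^ suc n
  permSum-at-origin n S |S| inc pos = begin
    ∑Sublists S (λ T → permSum T (0 , 0) * D (n ∸ length T)) ≡⟨ permSum-identity n S (0 , 0) |S| inc 0∉S ⟩
    τ ^ suc n * allAbove 0 S                                 ≡⟨ cong (τ ^ suc n *_) (allAbove-all 0 S pos) ⟩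
    τ ^ suc n * + 1                                          ≡⟨ ℤ.*-identityʳ _ ⟩
    τ ^ suc n                                                ∎
    where
    0∉S = All.All¬⇒¬Any (All.map ℕ.<⇒≢ pos)

  -- Read at (0 , 0), permSum-identity expresses (1-t) P_S through the values on proper
  -- sublists by a recursion that depends on S only through |S|; cancel 1-t ≠ 0.
  permSum-relabel : t ≢ + 1 → ∀ k S → length S ≡ k → AllPairs _<_ S → All (0 <_) S →
                    permSum S (0 , 0) ≡ permSum (oneTo k) (0 , 0)
  permSum-relabel t≢1 = <-rec _ step
    where
    g : ℕ → ℤ
    g k = permSum (oneTo k) (0 , 0)
    τ≢0 : τ ≢ + 0
    τ≢0 τ≡0 = t≢1 (sym (ℤ.i-j≡0⇒i≡j (+ 1) t τ≡0))
    step : ∀ k → (∀ {j} → j < k → ∀ S → length S ≡ j → AllPairs _<_ S → All (0 <_) S → permSum S (0 , 0) ≡ g j) →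
           ∀ S → length S ≡ k → AllPairs _<_ S → All (0 <_) S → permSum S (0 , 0) ≡ g k
    step k rec S |S| inc pos =
      ℤ.*-cancelʳ-≡ _ _ τ {{≢-nonZero τ≢0}}
        (∙-cancelʳ E _ _ (trans (identity-split S |S| inc pos)
                                 (sym (identity-split (oneTo k) (length-oneTo k) (oneTo-increasing k) (oneTo-positive k)))))
      where
      h : ℕ → ℤ
      h j = g j * D (k ∸ j)
      E : ℤ
      E = binomialSum k h - h k
      identity-split : ∀ S′ → length S′ ≡ k → AllPairs _<_ S′ → All (0 <_) S′ →
                    permSum S′ (0 , 0) * τ + E ≡ τ ^ suc k
      identity-split S′ |S′| inc′ pos′ = begin
        permSum S′ (0 , 0) * τ + E
          ≡⟨ cong₂ (λ j e → permSum S′ (0 , 0) * D j + e) (sym (trans (cong (k ∸_) |S′|) (ℕ.n∸n≡0 k))) (sym proper) ⟩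
        permSum S′ (0 , 0) * D (k ∸ length S′) + ∑ProperSublists S′ (λ T → permSum T (0 , 0) * D (k ∸ length T))
          ≡⟨ ∑Sublists-split S′ (λ T → permSum T (0 , 0) * D (k ∸ length T)) ⟨
        ∑Sublists S′ (λ T → permSum T (0 , 0) * D (k ∸ length T))
          ≡⟨ permSum-at-origin k S′ |S′| inc′ pos′ ⟩
        τ ^ suc k ∎
        where
        proper : ∑ProperSublists S′ (λ T → permSum T (0 , 0) * D (k ∸ length T)) ≡ E
        proper = begin
          ∑ProperSublists S′ (λ T → permSum T (0 , 0) * D (k ∸ length T))
            ≡⟨ ∑ProperSublists-cong S′ (λ T T⊆ |T|< → cong (_* D (k ∸ length T))
                 (rec (subst (length T <_) |S′| |T|<) T refl (AllPairs-resp-⊆ T⊆ inc′) (All-resp-⊆ T⊆ pos′))) ⟩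
          ∑ProperSublists S′ (h ∘ length)
            ≡⟨ ∑ProperSublists-length S′ h ⟩
          binomialSum (length S′) h - h (length S′)
            ≡⟨ cong (λ j → binomialSum j h - h j) |S′| ⟩
          E ∎

  F≡permSum : ∀ k → F r k t a ≡ permSum (oneTo k) (0 , 0)
  F≡permSum k = trans (F≡arrSum k) (cong (λ j → arrSum j (oneTo k) (0 , 0)) (sym (length-oneTo k)))

  egf-identity : t ≢ + 1 → ∀ n → egfProd (λ k → F r k t a) D n ≡ numCoeff t n
  egf-identity t≢1 n = begin
    egfProd (λ k → F r k t a) D n
      ≡⟨ egfProd-as-binomialSum (λ k → F r k t a) D n ⟩
    binomialSum n h
      ≡⟨ cong (λ j → binomialSum j h) (length-oneTo n) ⟨
    binomialSum (length (oneTo n)) h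
      ≡⟨ ∑Sublists-length (oneTo n) h ⟨
    ∑Sublists (oneTo n) (h ∘ length)
      ≡⟨ ∑Sublists-cong (oneTo n) (λ T T⊆ → cong (_* D (n ∸ length T)) (relabel T T⊆)) ⟩
    ∑Sublists (oneTo n) (λ T → permSum T (0 , 0) * D (n ∸ length T))
      ≡⟨ permSum-at-origin n (oneTo n) (length-oneTo n) (oneTo-increasing n) (oneTo-positive n) ⟩
    τ ^ suc n ∎
    where
    h : ℕ → ℤ
    h k = F r k t a * D (n ∸ k)
    relabel : ∀ T → T ⊆ oneTo n → F r (length T) t a ≡ permSum T (0 , 0)
    relabel T T⊆ = trans (F≡permSum (length T))
                         (sym (permSum-relabel t≢1 (length T) T refl (AllPairs-resp-⊆ T⊆ (oneTo-increasing n))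
                                                                  (All-resp-⊆ T⊆ (oneTo-positive n))))

proposition8p3 : (r : ℕ) → 1 ≤ r → (t a : ℤ) → (n : ℕ) →
    egfProd (λ k → F r k t a) (denomCoeff r t a) n ≡ numCoeff t n
proposition8p3 (suc m) _ t a n with t ℤ.≟ + 1
... | yes refl = egfProd-zeroʳ (λ k → F (suc m) k (+ 1) a) (denomCoeff (suc m) (+ 1) a) n (denomCoeff-at-one (suc m) a)
... | no  t≢1  = Colored.egf-identity m t a t≢1 n
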